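{- Let $q$ be a positive definite binary integral quadratic form which represents some positive integer $\equiv 3\pmod 4$, and assume $\operatorname{disc}(q)\equiv 16\pmod{32}$. Then $q$ primitively represents two integers $r_1,r_2$ with $r_1\equiv 3\pmod 8$ and $r_2\equiv 7\pmod 8$.
   Context: A binary integral form is $q=ax^2+bxy+cy^2$ with $a,b,c\in\mathbb Z$; $\operatorname{disc}(q)=b^2-4ac$. $q$ primitively represents $r$ if $r=q(x,y)$ with $\gcd(x,y)=1$. -}

module Defs where

open import Data.Integer using (ℤ; _+_; _*_; _-_; _<_; 0ℤ; 1ℤ; +_)
open import Data.Integer.GCD using (gcd)
open import Data.Integer.Base using (_%ℕ_)
open import Data.Nat using (ℕ)
open import Data.Product using (∃₂; _×_)
open import Data.Sum using (_⊎_)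
open import Relation.Binary.PropositionalEquality using (_≡_; _≢_)

record BinForm : Set where
  constructor form
  field
    a b c : ℤ

open BinForm public

eval : BinForm → ℤ → ℤ → ℤ
eval q x y = a q * x * x + b q * x * y + c q * y * y

disc : BinForm → ℤ
disc q = b q * b q - + 4 * a q * c q

PositiveDefinite : BinForm → Set
PositiveDefinite q = ∀ x y → (x ≢ 0ℤ ⊎ y ≢ 0ℤ) → 0ℤ < eval q x y

Represents : BinForm → ℤ → Set
Represents q r = ∃₂ λ x y → eval q x y ≡ r

PrimRepresents : BinForm → ℤ → Set
PrimRepresents q r = ∃₂ λ x y → gcd x y ≡ 1ℤ × eval q x y ≡ r

{-# OPTIONS --safe #-}
module Submission where

-- The hypotheses only involve disc q mod 32 and the values of q mod 4, the
-- conclusion only values of q mod 8 at fixed primitive vectors; all of these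
-- depend only on a, c mod 8 and b mod 16. The theorem thus reduces to a finite
-- check over the 8 · 16 · 8 residue forms, in each of which two of the values
-- q(1,0), q(0,1), q(1,1), q(-1,1) are ≡ 3 and ≡ 7 mod 8.

open import Defs
open import Data.Integer using (ℤ; _<_; 0ℤ; 1ℤ; _+_; _-_; _*_; -_; +_; -[1+_])
open import Data.Integer.Base using (_%ℕ_; _/ℕ_)
open import Data.Integer.DivMod using (a≡a%ℕn+[a/ℕn]*n; n%ℕd<d)
open import Data.Integer.GCD using (gcd)
open import Data.Integer.Properties using (+-injective; +-identityʳ; pos-+; pos-*)
open import Data.Integer.Tactic.RingSolver using (solve-∀)
import Data.Nat as ℕ
open import Data.Nat using (ℕ; suc; NonZero)
open import Data.Nat.Properties using (<⇒≱; m≤m+n; m≤n+m; ≤-trans)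
open import Data.Fin using (Fin; toℕ; fromℕ<)
open import Data.Fin.Properties using (all?; toℕ-fromℕ<)
open import Data.List using (List; []; _∷_)
open import Data.List.Relation.Unary.Any using (Any; any?; satisfied)
open import Data.Product using (∃; _×_; _,_; proj₁; proj₂)
open import Data.Empty using (⊥-elim)
open import Relation.Nullary using (Dec)
open import Relation.Nullary.Decidable using (toWitness; _→-dec_; _×-dec_)
open import Relation.Binary.PropositionalEquality
  using (_≡_; refl; sym; trans; cong; cong₂; subst; subst₂)

infix 4 _≡_mod_
record _≡_mod_ (u v : ℤ) (m : ℕ) : Set where
  constructor congruent
  field
    quotient : ℤ
    difference : u ≡ v + quotient * + m

≡-mod-refl : ∀ {m} u → u ≡ u mod m
≡-mod-refl u = congruent 0ℤ (sym (+-identityʳ u))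

≡-mod-sym : ∀ {m u v} → u ≡ v mod m → v ≡ u mod m
≡-mod-sym {m} {u} {v} (congruent k u≡) =
  congruent (- k) (trans (identity v k (+ m)) (cong (_+ - k * + m) (sym u≡)))
  where
  identity : ∀ v k m → v ≡ (v + k * m) + - k * m
  identity = solve-∀

≡-mod-trans : ∀ {m u v w} → u ≡ v mod m → v ≡ w mod m → u ≡ w mod m
≡-mod-trans {m} {w = w} (congruent k u≡) (congruent l v≡) =
  congruent (l + k) (trans u≡ (trans (cong (_+ k * + m) v≡) (identity w l k (+ m))))
  where
  identity : ∀ w l k m → (w + l * m) + k * m ≡ w + (l + k) * m
  identity = solve-∀

+-cong-mod : ∀ {m u u′ v v′} → u ≡ u′ mod m → v ≡ v′ mod m → u + v ≡ u′ + v′ mod m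
+-cong-mod {m} {u′ = u′} {v′ = v′} (congruent k u≡) (congruent l v≡) =
  congruent (k + l) (trans (cong₂ _+_ u≡ v≡) (identity u′ v′ k l (+ m)))
  where
  identity : ∀ u v k l m → (u + k * m) + (v + l * m) ≡ (u + v) + (k + l) * m
  identity = solve-∀

*-cong-mod : ∀ {m u u′ v v′} → u ≡ u′ mod m → v ≡ v′ mod m → u * v ≡ u′ * v′ mod m
*-cong-mod {m} {u′ = u′} {v′ = v′} (congruent k u≡) (congruent l v≡) =
  congruent (k * v′ + u′ * l + k * l * + m) (trans (cong₂ _*_ u≡ v≡) (identity u′ v′ k l (+ m)))
  where
  identity : ∀ u v k l m → (u + k * m) * (v + l * m) ≡ u * v + (k * v + u * l + k * l * m) * m
  identity = solve-∀

≡-mod-weaken : ∀ {d m u v} → u ≡ v mod d ℕ.* m → u ≡ v mod m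
≡-mod-weaken {d} {m} {v = v} (congruent k u≡) =
  congruent (k * + d)
    (trans u≡ (cong (_+_ v) (trans (cong (k *_) (pos-* d m)) (identity k (+ d) (+ m)))))
  where
  identity : ∀ k d m → k * (d * m) ≡ (k * d) * m
  identity = solve-∀

residue-unique : ∀ {m r s} → r ℕ.< m → s ℕ.< m → + r ≡ + s mod m → r ≡ s
residue-unique {s = s} _ _ (congruent (+ 0) r≡) = +-injective (trans r≡ (+-identityʳ (+ s)))
residue-unique {m} {r} {s} r<m _ (congruent (+ suc n) r≡) = ⊥-elim (<⇒≱ r<m m≤r)
  where
  r≡s+[1+n]m : r ≡ s ℕ.+ suc n ℕ.* m
  r≡s+[1+n]m = +-injective
    (trans r≡ (trans (cong (_+_ (+ s)) (sym (pos-* (suc n) m))) (sym (pos-+ s _))))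
  m≤r : m ℕ.≤ r
  m≤r = subst (m ℕ.≤_) (sym r≡s+[1+n]m) (≤-trans (m≤m+n m (n ℕ.* m)) (m≤n+m _ s))
residue-unique r<m s<m r≡s@(congruent -[1+ _ ] _) = sym (residue-unique s<m r<m (≡-mod-sym r≡s))

≡-mod-%ℕ : ∀ u m .{{_ : NonZero m}} → u ≡ + (u %ℕ m) mod m
≡-mod-%ℕ u m = congruent (u /ℕ m) (a≡a%ℕn+[a/ℕn]*n u m)

≡-mod⇒%ℕ≡ : ∀ {m u v} .{{_ : NonZero m}} → u ≡ v mod m → u %ℕ m ≡ v %ℕ m
≡-mod⇒%ℕ≡ {m} {u} {v} u≡v = residue-unique (n%ℕd<d u m) (n%ℕd<d v m)
  (≡-mod-trans (≡-mod-sym (≡-mod-%ℕ u m)) (≡-mod-trans u≡v (≡-mod-%ℕ v m)))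

residue : ℤ → (m : ℕ) .{{_ : NonZero m}} → Fin m
residue u m = fromℕ< (n%ℕd<d u m)

≡-mod-residue : ∀ u m .{{_ : NonZero m}} → u ≡ + toℕ (residue u m) mod m
≡-mod-residue u m = subst (λ r → u ≡ + r mod m) (sym (toℕ-fromℕ< (n%ℕd<d u m))) (≡-mod-%ℕ u m)

infix 4 _≈_mod_
_≈_mod_ : BinForm → BinForm → ℕ → Set
q ≈ q′ mod m = a q ≡ a q′ mod m × b q ≡ b q′ mod m × c q ≡ c q′ mod m

≈-mod-weaken : ∀ {d m q q′} → q ≈ q′ mod d ℕ.* m → q ≈ q′ mod m
≈-mod-weaken {d} (a≡ , b≡ , c≡) = ≡-mod-weaken {d} a≡ , ≡-mod-weaken {d} b≡ , ≡-mod-weaken {d} c≡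

eval-cong : ∀ {m q q′ x x′ y y′} → q ≈ q′ mod m → x ≡ x′ mod m → y ≡ y′ mod m
          → eval q x y ≡ eval q′ x′ y′ mod m
eval-cong (a≡ , b≡ , c≡) x≡ y≡ =
  +-cong-mod (+-cong-mod (*-cong-mod (*-cong-mod a≡ x≡) x≡) (*-cong-mod (*-cong-mod b≡ x≡) y≡))
             (*-cong-mod (*-cong-mod c≡ y≡) y≡)

disc-cong : ∀ {m q q′} → q ≈ q′ mod m → b q ≡ b q′ mod 2 ℕ.* m → disc q ≡ disc q′ mod 4 ℕ.* m
disc-cong {m} {form _ _ _} {form a′ b′ c′} (congruent k refl , _ , congruent l refl) (congruent j refl) =
  congruent K (subst₂ (λ M₂ M₄ → disc (form (a′ + k * + m) (b′ + j * M₂) (c′ + l * + m))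
                                 ≡ disc (form a′ b′ c′) + K * M₄)
                      (sym (pos-* 2 m)) (sym (pos-* 4 m))
                      (identity a′ b′ c′ k j l (+ m)))
  where
  K : ℤ
  K = b′ * j + + m * j * j - a′ * l - k * c′ - + m * k * l
  identity : ∀ a b c k j l m
    → (b + j * (+ 2 * m)) * (b + j * (+ 2 * m)) - + 4 * (a + k * m) * (c + l * m)
      ≡ (b * b - + 4 * a * c) + (b * j + m * j * j - a * l - k * c - m * k * l) * (+ 4 * m)
  identity = solve-∀

record CoprimePair : Set where
  constructor coprimePair
  field
    x y : ℤ
    coprime : gcd x y ≡ 1ℤ

open CoprimePair

testVectors : List CoprimePair
testVectors = coprimePair (+ 1) (+ 0) refl ∷ coprimePair (+ 0) (+ 1) refl
            ∷ coprimePair (+ 1) (+ 1) refl ∷ coprimePair (- + 1) (+ 1) refl ∷ []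

TakesOnTestVector : BinForm → ℕ → Set
TakesOnTestVector q t = Any (λ v → eval q (x v) (y v) %ℕ 8 ≡ t) testVectors

takesOnTestVector? : ∀ q t → Dec (TakesOnTestVector q t)
takesOnTestVector? q t = any? (λ v → eval q (x v) (y v) %ℕ 8 ℕ.≟ t) testVectors

takesOnTestVector⇒primRepresents : ∀ {q q′ t} → q ≈ q′ mod 8 → TakesOnTestVector q′ t
                                 → ∃ λ r → PrimRepresents q r × r %ℕ 8 ≡ t
takesOnTestVector⇒primRepresents {q} q≈q′ takes with satisfied takes
... | coprimePair x y coprime , q′xy≡t =
  eval q x y , (x , y , coprime , refl) ,
  trans (≡-mod⇒%ℕ≡ {8} (eval-cong q≈q′ (≡-mod-refl x) (≡-mod-refl y))) q′xy≡t

ResidueClaim : BinForm → Set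
ResidueClaim q = disc q %ℕ 32 ≡ 16
               → (X Y : Fin 4) → eval q (+ toℕ X) (+ toℕ Y) %ℕ 4 ≡ 3
               → TakesOnTestVector q 3 × TakesOnTestVector q 7

residueClaim? : ∀ q → Dec (ResidueClaim q)
residueClaim? q = disc q %ℕ 32 ℕ.≟ 16 →-dec all? λ X → all? λ Y →
  eval q (+ toℕ X) (+ toℕ Y) %ℕ 4 ℕ.≟ 3 →-dec (takesOnTestVector? q 3 ×-dec takesOnTestVector? q 7)

residueForm : Fin 8 → Fin 16 → Fin 8 → BinForm
residueForm A B C = form (+ toℕ A) (+ toℕ B) (+ toℕ C)

residueClaim : ∀ A B C → ResidueClaim (residueForm A B C)
residueClaim = toWitness {a? = all? λ A → all? λ B → all? λ C → residueClaim? (residueForm A B C)} _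

lemma20 : (q : BinForm) → PositiveDefinite q
        → (∃ λ r → 0ℤ < r × r %ℕ 4 ≡ 3 × Represents q r)
        → disc q %ℕ 32 ≡ 16
        → ∃ λ r₁ → ∃ λ r₂ → (PrimRepresents q r₁ × r₁ %ℕ 8 ≡ 3) × (PrimRepresents q r₂ × r₂ %ℕ 8 ≡ 7)
lemma20 q _ (r , _ , r%4≡3 , x , y , qxy≡r) disc%32≡16 =
  proj₁ rep₃ , proj₁ rep₇ , proj₂ rep₃ , proj₂ rep₇
  where
  A C : Fin 8
  A = residue (a q) 8
  C = residue (c q) 8
  B : Fin 16
  B = residue (b q) 16
  q̄ : BinForm
  q̄ = residueForm A B C
  q≈q̄ : q ≈ q̄ mod 8
  q≈q̄ = ≡-mod-residue (a q) 8 , ≡-mod-weaken {2} (≡-mod-residue (b q) 16) , ≡-mod-residue (c q) 8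
  X Y : Fin 4
  X = residue x 4
  Y = residue y 4
  disc-q̄ : disc q̄ %ℕ 32 ≡ 16
  disc-q̄ = trans (sym (≡-mod⇒%ℕ≡ {32} (disc-cong q≈q̄ (≡-mod-residue (b q) 16)))) disc%32≡16
  q̄XY : eval q̄ (+ toℕ X) (+ toℕ Y) %ℕ 4 ≡ 3
  q̄XY = trans (sym (≡-mod⇒%ℕ≡ {4} (eval-cong (≈-mod-weaken {2} q≈q̄)
                                                (≡-mod-residue x 4) (≡-mod-residue y 4))))
              (trans (cong (_%ℕ 4) qxy≡r) r%4≡3)
  takes : TakesOnTestVector q̄ 3 × TakesOnTestVector q̄ 7
  takes = residueClaim A B C disc-q̄ X Y q̄XY
  rep₃ : ∃ λ r → PrimRepresents q r × r %ℕ 8 ≡ 3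
  rep₃ = takesOnTestVector⇒primRepresents q≈q̄ (proj₁ takes)
  rep₇ : ∃ λ r → PrimRepresents q r × r %ℕ 8 ≡ 7
  rep₇ = takesOnTestVector⇒primRepresents q≈q̄ (proj₂ takes)
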